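{- Let $G$ be a connected graph containing a vertex $u$ of degree $1$ and a vertex $v$ of maximum degree $\Delta \geq 2$ such that $u$ and $v$ are not adjacent. Then $mp(G+uv) \leq mp(G)$; in particular, $G$ is not saturated.
   Context: All graphs are finite and simple. A degree monotone path in a graph $G$ is a path $v_1v_2\ldots v_m$ such that $\deg(v_1)\le\cdots\le\deg(v_m)$ or $\deg(v_1)\ge\cdots\ge\deg(v_m)$, where degrees are taken in $G$. Its length is its number of vertices $m$. $mp(G)$ denotes the maximum length of a degree monotone path in $G$. For nonadjacent distinct vertices $x,y$, $G+xy$ is $G$ with the edge $xy$ added, and degrees in $G+xy$ are computed in that graph. A graph $G$ is called saturated if $mp(G+e) > mp(G)$ for every edge $e$ joining two nonadjacent vertices of $G$. -}

module Defs where

open import Data.Nat using (ℕ; zero; suc; _≤_; _≥_; _<_)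
open import Data.Fin using (Fin; _≟_)
open import Data.Bool using (Bool; true; false; _∨_; _∧_; if_then_else_)
open import Data.List using (List; length; map)
open import Data.Nat.ListAction using (sum)
open import Data.List using (allFin)
open import Data.List.Relation.Unary.Linked using (Linked)
open import Data.List.Relation.Unary.Unique.Propositional using (Unique)
open import Data.Product using (Σ; _×_; ∃)
open import Data.Sum using (_⊎_)
open import Relation.Binary.PropositionalEquality using (_≡_; _≢_)
open import Relation.Nullary using (¬_)
open import Relation.Nullary.Decidable using (⌊_⌋)

record Graph : Set where
  constructor mkGraph
  field
    n   : ℕ
    adj : Fin n → Fin n → Bool
open Graph public

Adj : (G : Graph) → Fin (n G) → Fin (n G) → Set
Adj G x y = adj G x y ≡ true

IsSimple : Graph → Set
IsSimple G = (∀ x y → adj G x y ≡ adj G y x) × (∀ x → adj G x x ≡ false)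

deg : (G : Graph) → Fin (n G) → ℕ
deg G x = sum (map (λ y → if adj G x y then 1 else 0) (allFin (n G)))

addEdge : (G : Graph) → Fin (n G) → Fin (n G) → Graph
addEdge G x y = mkGraph (n G) (λ a b →
  adj G a b ∨ (⌊ a ≟ x ⌋ ∧ ⌊ b ≟ y ⌋) ∨ (⌊ a ≟ y ⌋ ∧ ⌊ b ≟ x ⌋))

IsPath : (G : Graph) → List (Fin (n G)) → Set
IsPath G p = Unique p × Linked (Adj G) p

IsMonotone : (G : Graph) → List (Fin (n G)) → Set
IsMonotone G p = Linked (λ a b → deg G a ≤ deg G b) p
               ⊎ Linked (λ a b → deg G a ≥ deg G b) p

IsDegMonotonePath : (G : Graph) → List (Fin (n G)) → Set
IsDegMonotonePath G p = IsPath G p × IsMonotone G p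

IsMP : Graph → ℕ → Set
IsMP G k = Σ (List (Fin (n G))) (λ p → IsDegMonotonePath G p × length p ≡ k)
         × (∀ p → IsDegMonotonePath G p → length p ≤ k)

data Reach (G : Graph) : Fin (n G) → Fin (n G) → Set where
  here : ∀ {x} → Reach G x x
  step : ∀ {x y z} → Adj G x y → Reach G y z → Reach G x z

Connected : Graph → Set
Connected G = ∀ x y → Reach G x y

Saturated : Graph → Set
Saturated G = ∀ x y → x ≢ y → ¬ Adj G x y →
  ∀ a b → IsMP G a → IsMP (addEdge G x y) b → a < b

module Submission where

-- Let u be a leaf and v a vertex of maximum degree Δ ≥ 2 of a connected graph G,
-- u and v non-adjacent, and write G' = G + uv.  In G' the degree of u is 2, the
-- degree of v is Δ + 1 (strictly the largest), and all other degrees are unchanged.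
-- We show that every degree monotone path P of G' is dominated by a degree monotone
-- path Q of G with |P| ≤ |Q|; hence mp(G') ≤ mp(G) and G is not saturated.
--
-- Reversing if necessary, P is nondecreasing in G'-degree.  If P avoids u it is
-- already a path of G.  Otherwise P = A ++ u ∷ B.  If A is empty, either P is a path
-- of G or P = u v, which we replace by u w for the G-neighbour w of u.  If A is not
-- empty, all of A has degree at most 2, so A ++ [u] is a pendant segment of G of
-- vertices of degree ≤ 2 ending in the leaf u, and B has at most one vertex.  By
-- connectivity the segment can only be left through its first vertex, which yields
-- a vertex x of degree ≥ 2 such that x ∷ A ++ [u] is a nonincreasing path of G.

open import Defs
open import Data.Nat using (ℕ; zero; suc; _+_; _≤_; _≥_; z≤n; s≤s; _≤?_)
open import Data.Nat.Properties
  using (≤-refl; ≤-trans; ≤-reflexive; ≤-pred; +-suc; +-monoʳ-≤; 1+n≰n; <⇒≱; suc-injective; ≤∧≢⇒<; module ≤-Reasoning)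
open import Data.Fin using (Fin; zero; suc; _≟_)
open import Data.Fin.Properties using (any?) renaming (suc-injective to Fin-suc-injective)
open import Data.Bool using (Bool; true; false; _∨_; _∧_; not; if_then_else_)
open import Data.Bool.Properties
  using (∨-identityʳ; ∨-zeroʳ; ∧-identityʳ; ∧-zeroʳ; ∧-conicalˡ; ∧-conicalʳ; ∨-comm; ∧-comm; ¬-not)
  renaming (_≟_ to _≟ᵇ_)
open import Data.List using (List; []; _∷_; [_]; _++_; length; map; allFin; tabulate; reverse; _ʳ++_)
open import Data.List.Properties using (map-tabulate; length-++; length-reverse)
open import Data.Nat.ListAction using (sum)
open import Data.List.Relation.Unary.Linked as Linked using (Linked; []; [-]; _∷_; linked?)
open import Data.List.Relation.Unary.AllPairs using ([]; _∷_)
open import Data.List.Relation.Unary.Unique.Propositional using (Unique)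
import Data.List.Relation.Unary.Unique.DecPropositional as UniqueDec
open import Data.List.Relation.Unary.All as All using (All; []; _∷_)
open import Data.List.Relation.Unary.All.Properties using (¬Any⇒All¬; ++⁻ˡ; ++⁻ʳ; ∷ʳ⁺)
open import Data.List.Relation.Unary.Any as Any using (here; there)
open import Data.List.Membership.Propositional using (_∈_; _∉_)
open import Data.List.Membership.Propositional.Properties using (∈-∃++; ∈-++⁺ˡ; ∈-++⁺ʳ; ∈-++⁻)
open import Data.List.Relation.Binary.Permutation.Propositional using (↭⇒↭ₛ′; ↭-sym)
open import Data.List.Relation.Binary.Permutation.Propositional.Properties using (↭-reverse)
import Data.List.Relation.Binary.Permutation.Setoid.Properties as PermutationSetoid
open import Data.Product using (Σ; _×_; _,_; proj₂)
open import Data.Sum using (_⊎_; inj₁; inj₂)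
open import Data.Empty using (⊥; ⊥-elim)
open import Function using (_∘_; id; flip)
open import Relation.Binary.PropositionalEquality
  using (_≡_; _≢_; refl; sym; trans; cong; cong₂; subst; subst₂; ≢-sym; setoid; isEquivalence; module ≡-Reasoning)
open import Relation.Nullary using (¬_; yes; no; Dec)
open import Relation.Nullary.Decidable using (⌊_⌋; isYes≗does; dec-true; dec-false; _×-dec_; _⊎-dec_)

⌊⌋-true : ∀ {A : Set} (d : Dec A) → A → ⌊ d ⌋ ≡ true
⌊⌋-true d a = trans (isYes≗does d) (dec-true d a)

⌊⌋-false : ∀ {A : Set} (d : Dec A) → ¬ A → ⌊ d ⌋ ≡ false
⌊⌋-false d ¬a = trans (isYes≗does d) (dec-false d ¬a)

⌊⌋-sound : ∀ {A : Set} (d : Dec A) → ⌊ d ⌋ ≡ true → A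
⌊⌋-sound (yes a) _ = a

∨-true : ∀ a b → a ∨ b ≡ true → a ≡ true ⊎ b ≡ true
∨-true true  _ _ = inj₁ refl
∨-true false _ e = inj₂ e

-- Counting the points where a Boolean function on Fin m is true.
-- By definition deg G x = count (adj G x).

indicator : Bool → ℕ
indicator b = if b then 1 else 0

count : ∀ {m} → (Fin m → Bool) → ℕ
count {m} f = sum (map (λ y → indicator (f y)) (allFin m))

count-suc : ∀ {m} (f : Fin (suc m) → Bool) → count f ≡ indicator (f zero) + count (f ∘ suc)
count-suc {m} f = cong (λ ys → indicator (f zero) + sum ys) (begin
  map g (tabulate suc)        ≡⟨ map-tabulate suc g ⟩
  tabulate (g ∘ suc)          ≡⟨ sym (map-tabulate id (g ∘ suc)) ⟩
  map (g ∘ suc) (allFin m)    ∎)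
  where
  open ≡-Reasoning
  g = λ y → indicator (f y)

count-cong : ∀ {m} (f g : Fin m → Bool) → (∀ y → f y ≡ g y) → count f ≡ count g
count-cong {zero}  f g f≗g = refl
count-cong {suc m} f g f≗g = begin
  count f                                      ≡⟨ count-suc f ⟩
  indicator (f zero) + count (f ∘ suc)         ≡⟨ cong₂ _+_ (cong indicator (f≗g zero))
                                                     (count-cong (f ∘ suc) (g ∘ suc) (f≗g ∘ suc)) ⟩
  indicator (g zero) + count (g ∘ suc)         ≡⟨ sym (count-suc g) ⟩
  count g                                      ∎
  where open ≡-Reasoning

count-remove : ∀ {m} (f g : Fin m → Bool) a → f a ≡ true → g a ≡ false →
  (∀ y → y ≢ a → g y ≡ f y) → count f ≡ suc (count g)
count-remove {suc m} f g zero fa ga agree = begin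
  count f                                  ≡⟨ count-suc f ⟩
  indicator (f zero) + count (f ∘ suc)     ≡⟨ cong₂ _+_ (cong indicator fa)
                                                 (count-cong (f ∘ suc) (g ∘ suc) (λ y → sym (agree (suc y) λ ()))) ⟩
  suc (count (g ∘ suc))                    ≡⟨ cong (λ b → suc (indicator b + count (g ∘ suc))) (sym ga) ⟩
  suc (indicator (g zero) + count (g ∘ suc)) ≡⟨ cong suc (sym (count-suc g)) ⟩
  suc (count g)                            ∎
  where open ≡-Reasoning
count-remove {suc m} f g (suc a) fa ga agree = begin
  count f                                        ≡⟨ count-suc f ⟩
  indicator (f zero) + count (f ∘ suc)           ≡⟨ cong₂ _+_ (cong indicator (sym (agree zero λ ())))
                                                       (count-remove (f ∘ suc) (g ∘ suc) a fa ga
                                                         (λ y y≢a → agree (suc y) (y≢a ∘ Fin-suc-injective))) ⟩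
  indicator (g zero) + suc (count (g ∘ suc))     ≡⟨ +-suc (indicator (g zero)) _ ⟩
  suc (indicator (g zero) + count (g ∘ suc))     ≡⟨ cong suc (sym (count-suc g)) ⟩
  suc (count g)                                  ∎
  where open ≡-Reasoning

count-witness : ∀ {m} (f : Fin m → Bool) → 1 ≤ count f → Σ (Fin m) λ y → f y ≡ true
count-witness {suc m} f pos = first-or-rest (f zero) refl (subst (1 ≤_) (count-suc f) pos)
  where
  first-or-rest : ∀ b → f zero ≡ b → 1 ≤ indicator b + count (f ∘ suc) → Σ (Fin (suc m)) λ y → f y ≡ true
  first-or-rest true  f0 _    = zero , f0
  first-or-rest false _  rest with count-witness (f ∘ suc) rest
  ... | y , fy = suc y , fy

count-insert : ∀ {m} (f : Fin m → Bool) a → f a ≡ false → count (λ y → f y ∨ ⌊ y ≟ a ⌋) ≡ suc (count f)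
count-insert f a fa = count-remove _ f a on fa agree
  where
  on : f a ∨ ⌊ a ≟ a ⌋ ≡ true
  on rewrite ⌊⌋-true (a ≟ a) refl = ∨-zeroʳ (f a)
  agree : ∀ y → y ≢ a → f y ≡ f y ∨ ⌊ y ≟ a ⌋
  agree y y≢a rewrite ⌊⌋-false (y ≟ a) y≢a = sym (∨-identityʳ (f y))

without : ∀ {m} → (Fin m → Bool) → Fin m → Fin m → Bool
without f a y = f y ∧ not ⌊ y ≟ a ⌋

without-agrees : ∀ {m} (f : Fin m → Bool) {a} y → y ≢ a → without f a y ≡ f y
without-agrees f {a} y y≢a rewrite ⌊⌋-false (y ≟ a) y≢a = ∧-identityʳ (f y)

count-≥-length : ∀ {m} (f : Fin m → Bool) {xs} → Unique xs → All (λ y → f y ≡ true) xs → length xs ≤ count f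
count-≥-length f []            []        = z≤n
count-≥-length f {x ∷ xs} (x∉ ∷ U) (fx ∷ F) =
  subst (suc (length xs) ≤_) (sym (count-remove f (without f x) x fx off (without-agrees f)))
    (s≤s (count-≥-length (without f x) U (All.zipWith still-on (x∉ , F))))
  where
  off : without f x x ≡ false
  off rewrite ⌊⌋-true (x ≟ x) refl = ∧-zeroʳ (f x)
  still-on : ∀ {y} → x ≢ y × f y ≡ true → without f x y ≡ true
  still-on {y} (x≢y , fy) = trans (without-agrees f y (≢-sym x≢y)) fy

count-true : ∀ m → count {m} (λ _ → true) ≡ m
count-true zero    = refl
count-true (suc m) = trans (count-suc {m} (λ _ → true)) (cong suc (count-true m))

distinct-length-≤ : ∀ {m} {xs : List (Fin m)} → Unique xs → length xs ≤ m
distinct-length-≤ {m} {xs} U =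
  subst (length xs ≤_) (count-true m) (count-≥-length (λ _ → true) U (All.universal (λ _ → refl) xs))

module _ {A : Set} where

  linked-map-on : ∀ {P : A → Set} {R S : A → A → Set} → (∀ {a b} → P a → P b → R a b → S a b) →
    ∀ {xs} → All P xs → Linked R xs → Linked S xs
  linked-map-on f []           []      = []
  linked-map-on f (p ∷ [])     [-]     = [-]
  linked-map-on f (p ∷ q ∷ ps) (r ∷ l) = f p q r ∷ linked-map-on f (q ∷ ps) l

  linked-prefix : ∀ {R : A → A → Set} xs y ys → Linked R (xs ++ y ∷ ys) → Linked R (xs ++ [ y ])
  linked-prefix []            y ys l       = [-]
  linked-prefix (x ∷ [])      y ys (r ∷ l) = r ∷ [-]
  linked-prefix (x ∷ x′ ∷ xs) y ys (r ∷ l) = r ∷ linked-prefix (x′ ∷ xs) y ys l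

  linked-suffix : ∀ {R : A → A → Set} xs ys → Linked R (xs ++ ys) → Linked R ys
  linked-suffix []       ys l = l
  linked-suffix (x ∷ xs) ys l = linked-suffix xs ys (Linked.tail l)

  linked-before : ∀ {R : A → A → Set} → (∀ {a b c} → R a b → R b c → R a c) →
    ∀ xs y ys → Linked R (xs ++ y ∷ ys) → All (λ x → R x y) xs
  linked-before tr []            y ys l       = []
  linked-before tr (x ∷ [])      y ys (r ∷ l) = r ∷ []
  linked-before tr (x ∷ x′ ∷ xs) y ys (r ∷ l) with linked-before tr (x′ ∷ xs) y ys l
  ... | r′ ∷ rs = tr r r′ ∷ r′ ∷ rs

  first-edge : ∀ {R : A → A → Set} a L c → Linked R (a ∷ L ++ [ c ]) → Σ A λ q → q ∈ L ++ [ c ] × R a q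
  first-edge a []      c (r ∷ _) = c , here refl , r
  first-edge a (b ∷ L) c (r ∷ _) = b , here refl , r

  last-edge : ∀ {R : A → A → Set} a L c → Linked R (a ∷ L ++ [ c ]) → Σ A λ z → z ∈ a ∷ L × R z c
  last-edge a []      c (r ∷ _) = a , here refl , r
  last-edge a (b ∷ L) c (r ∷ l) with last-edge b L c l
  ... | z , z∈ , rz = z , there z∈ , rz

  unique-prefix : ∀ xs (y : A) ys → Unique (xs ++ y ∷ ys) → Unique (xs ++ [ y ])
  unique-prefix []       y ys (_ ∷ _) = [] ∷ []
  unique-prefix (x ∷ xs) y ys (x∉ ∷ U) =
    ∷ʳ⁺ (++⁻ˡ xs x∉) (All.head (++⁻ʳ xs x∉)) ∷ unique-prefix xs y ys U

  unique-suffix : ∀ xs {ys : List A} → Unique (xs ++ ys) → Unique ys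
  unique-suffix []       U       = U
  unique-suffix (x ∷ xs) (_ ∷ U) = unique-suffix xs U

  unique-disjoint : ∀ xs {ys : List A} {a b} → Unique (xs ++ ys) → a ∈ xs → b ∈ ys → a ≢ b
  unique-disjoint (x ∷ xs) (x∉ ∷ U) (here refl) b∈ = All.lookup (++⁻ʳ xs x∉) b∈
  unique-disjoint (x ∷ xs) (_ ∷ U)  (there a∈)  b∈ = unique-disjoint xs U a∈ b∈

  ∈-∉-≢ : ∀ {a b : A} {xs} → a ∈ xs → b ∉ xs → a ≢ b
  ∈-∉-≢ a∈ b∉ refl = b∉ a∈

  linked-reverse-onto : ∀ {R : A → A → Set} {x xs acc} → Linked R (x ∷ xs) → Linked (flip R) (x ∷ acc) →
    Linked (flip R) ((x ∷ xs) ʳ++ acc)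
  linked-reverse-onto [-]     racc = racc
  linked-reverse-onto (r ∷ l) racc = linked-reverse-onto l (r ∷ racc)

  linked-reverse : ∀ {R : A → A → Set} {xs} → Linked R xs → Linked (flip R) (reverse xs)
  linked-reverse []        = []
  linked-reverse l@[-]     = linked-reverse-onto l [-]
  linked-reverse l@(_ ∷ _) = linked-reverse-onto l [-]

  unique-reverse : ∀ {xs : List A} → Unique xs → Unique (reverse xs)
  unique-reverse {xs} = PermutationSetoid.Unique-resp-↭ (setoid A) (↭⇒↭ₛ′ isEquivalence (↭-sym (↭-reverse xs)))

module _ (G : Graph) where

  private V = Fin (n G)

  degree-≥ : ∀ {x} {ys : List V} → Unique ys → All (Adj G x) ys → length ys ≤ deg G x
  degree-≥ {x} = count-≥-length (adj G x)

  neighbour : ∀ {x} → 1 ≤ deg G x → Σ V (Adj G x)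
  neighbour {x} = count-witness (adj G x)

  escape : ∀ (S : List V) {a b} → Reach G a b → a ∈ S → b ∉ S →
    Σ V λ s → Σ V λ y → s ∈ S × y ∉ S × Adj G s y
  escape S here                    a∈ b∉ = ⊥-elim (b∉ a∈)
  escape S (step {y = y} a~y walk) a∈ b∉ with Any.any? (y ≟_) S
  ... | yes y∈ = escape S walk y∈ b∉
  ... | no  y∉ = _ , y , a∈ , y∉ , a~y

  IsNondecreasingPath : List V → Set
  IsNondecreasingPath p = IsPath G p × Linked (λ a b → deg G a ≤ deg G b) p

  nondecreasing-form : (∀ a b → adj G a b ≡ adj G b a) → ∀ p → IsDegMonotonePath G p →
    Σ (List V) λ q → IsNondecreasingPath q × length q ≡ length p
  nondecreasing-form symmetric p (path , inj₁ up)          = p , (path , up) , refl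
  nondecreasing-form symmetric p ((U , L) , inj₂ down) =
    reverse p , ((unique-reverse U , Linked.map (λ {a} {b} e → trans (symmetric a b) e) (linked-reverse L)) ,
                 linked-reverse down) , length-reverse p

module SymmetricGraph (G : Graph) (symmetric : ∀ a b → adj G a b ≡ adj G b a) where

  private V = Fin (n G)

  Adj-sym : ∀ {a b} → Adj G a b → Adj G b a
  Adj-sym {a} {b} e = trans (symmetric b a) e

  record TwoNeighboursIn (S : List V) (s : V) : Set where
    constructor two-neighbours
    field
      left right      : V
      left∈           : left ∈ S
      right∈          : right ∈ S
      distinct        : left ≢ right
      s~left          : Adj G s left
      s~right         : Adj G s right

  two-neighbours-there : ∀ {x S s} → TwoNeighboursIn S s → TwoNeighboursIn (x ∷ S) s
  two-neighbours-there (two-neighbours l r l∈ r∈ l≢r s~l s~r) = two-neighbours l r (there l∈) (there r∈) l≢r s~l s~r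

  interior-neighbours : ∀ a L c → IsPath G (a ∷ L ++ [ c ]) → ∀ {s} → s ∈ L → TwoNeighboursIn (a ∷ L ++ [ c ]) s
  interior-neighbours a (b ∷ L) c (a∉ ∷ _ , a~b ∷ P) (here refl) with first-edge b L c P
  ... | q , q∈ , b~q = two-neighbours a q (here refl) (there (there q∈)) (All.lookup a∉ (there q∈)) (Adj-sym a~b) b~q
  interior-neighbours a (b ∷ L) c (_ ∷ U , _ ∷ P) (there s∈) =
    two-neighbours-there (interior-neighbours b L c (U , P) s∈)

  interior-degree : ∀ a L c → IsPath G (a ∷ L ++ [ c ]) → All (λ s → 2 ≤ deg G s) L
  interior-degree a L c path = All.tabulate (λ s∈ → two-degree (interior-neighbours a L c path s∈))
    where
    two-degree : ∀ {S s} → TwoNeighboursIn S s → 2 ≤ deg G s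
    two-degree (two-neighbours l r _ _ l≢r s~l s~r) = degree-≥ G ((l≢r ∷ []) ∷ [] ∷ []) (s~l ∷ s~r ∷ [])

-- In a connected graph with a leaf u, call a path a ∷ L ++ [u]
-- whose interior L has degree ≤ 2 a pendant segment.  Every vertex of L ++ [u] has
-- all its neighbours on the segment, so by connectivity the segment is left through a.

module PendantSegment (G : Graph) (symmetric : ∀ a b → adj G a b ≡ adj G b a) (connected : Connected G)
  (u : Fin (n G)) (deg-u : deg G u ≡ 1) where

  open SymmetricGraph G symmetric

  private V = Fin (n G)

  leaf-neighbour-unique : ∀ {p q} → Adj G u p → Adj G u q → p ≡ q
  leaf-neighbour-unique {p} {q} u~p u~q with p ≟ q
  ... | yes p≡q = p≡q
  ... | no  p≢q = ⊥-elim (1+n≰n (subst (2 ≤_) deg-u (degree-≥ G ((p≢q ∷ []) ∷ [] ∷ []) (u~p ∷ u~q ∷ []))))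

  leaf-below : ∀ {y} → Adj G u y → deg G u ≤ deg G y
  leaf-below u~y = subst (_≤ _) (sym deg-u) (degree-≥ G ([] ∷ []) (Adj-sym u~y ∷ []))

  interior-closed : ∀ {S s y} → TwoNeighboursIn S s → deg G s ≤ 2 → Adj G s y → y ∉ S → ⊥
  interior-closed (two-neighbours l r l∈ r∈ l≢r s~l s~r) small s~y y∉ =
    1+n≰n (≤-trans (degree-≥ G ((l≢r ∷ ∈-∉-≢ l∈ y∉ ∷ []) ∷ (∈-∉-≢ r∈ y∉ ∷ []) ∷ [] ∷ [])
                               (s~l ∷ s~r ∷ s~y ∷ [])) small)

  leaf-closed : ∀ {S z y} → z ∈ S → Adj G z u → Adj G u y → y ∉ S → ⊥
  leaf-closed z∈ z~u u~y y∉ = ∈-∉-≢ z∈ y∉ (leaf-neighbour-unique (Adj-sym z~u) u~y)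

  closed-segment : ∀ a L → IsPath G (a ∷ L ++ [ u ]) → All (λ s → deg G s ≤ 2) L →
    ∀ {s y} → s ∈ L ++ [ u ] → Adj G s y → y ∉ a ∷ L ++ [ u ] → ⊥
  closed-segment a L path small s∈ s~y y∉ with ∈-++⁻ L s∈
  ... | inj₁ s∈L        = interior-closed (interior-neighbours a L u path s∈L) (All.lookup small s∈L) s~y y∉
  ... | inj₂ (here refl) with last-edge a L u (proj₂ path)
  ...   | z , z∈ , z~u = leaf-closed (∈-++⁺ˡ z∈) z~u s~y y∉

  exit-from-head : ∀ a L → IsPath G (a ∷ L ++ [ u ]) → All (λ s → deg G s ≤ 2) L →
    ∀ {b} → b ∉ a ∷ L ++ [ u ] → Σ V λ y → y ∉ a ∷ L ++ [ u ] × Adj G a y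
  exit-from-head a L path small {b} b∉
    with escape G (a ∷ L ++ [ u ]) (connected u b) (there (∈-++⁺ʳ L (here refl))) b∉
  ... | _ , y , here refl , y∉ , a~y = y , y∉ , a~y
  ... | _ , y , there s∈  , y∉ , s~y = ⊥-elim (closed-segment a L path small s∈ s~y y∉)

  nonincreasing-pendant : ∀ {x} L → 2 ≤ deg G x → All (λ s → deg G s ≤ 2 × 2 ≤ deg G s) L →
    Linked (λ a b → deg G a ≥ deg G b) (x ∷ L ++ [ u ])
  nonincreasing-pendant []      deg-x []                = ≤-trans (≤-reflexive deg-u) (≤-trans (s≤s z≤n) deg-x) ∷ [-]
  nonincreasing-pendant (s ∷ L) deg-x ((≤2 , ≥2) ∷ two) = ≤-trans ≤2 deg-x ∷ nonincreasing-pendant L ≥2 two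

  pendant-extension : ∀ w L → IsPath G (w ∷ L ++ [ u ]) → All (λ s → deg G s ≤ 2) (w ∷ L) →
    ∀ {v} → v ∉ w ∷ L ++ [ u ] → 2 ≤ deg G v → Σ V λ x → IsDegMonotonePath G (x ∷ w ∷ L ++ [ u ])
  pendant-extension w L path@(U , P) small {v} v∉ deg-v with exit-from-head w L path (All.tail small) v∉
  ... | x , x∉ , w~x =
    x , (path′ , inj₂ (nonincreasing-pendant (w ∷ L) deg-x (All.zip (small , interior-degree x (w ∷ L) u path′))))
    where
    path′ : IsPath G (x ∷ w ∷ L ++ [ u ])
    path′ = ¬Any⇒All¬ _ x∉ ∷ U , Adj-sym w~x ∷ P
    v∉′ : x ≢ v → v ∉ x ∷ w ∷ L ++ [ u ]
    v∉′ x≢v (here v≡x) = x≢v (sym v≡x)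
    v∉′ x≢v (there v∈) = v∉ v∈
    deg-x : 2 ≤ deg G x
    deg-x with x ≟ v
    ... | yes refl = deg-v
    ... | no  x≢v with exit-from-head x (w ∷ L) path′ small (v∉′ x≢v)
    ...   | y , y∉ , x~y = degree-≥ G ((∈-∉-≢ (there (here refl)) y∉ ∷ []) ∷ [] ∷ []) (Adj-sym w~x ∷ x~y ∷ [])

module _ (G : Graph) (x y : Fin (n G)) where

  private
    V    = Fin (n G)
    G+xy = addEdge G x y

  addEdge-adj : ∀ {a b} → Adj G+xy a b → Adj G a b ⊎ ((a ≡ x × b ≡ y) ⊎ (a ≡ y × b ≡ x))
  addEdge-adj {a} {b} e with ∨-true (adj G a b) _ e
  ... | inj₁ old = inj₁ old
  ... | inj₂ new with ∨-true (⌊ a ≟ x ⌋ ∧ ⌊ b ≟ y ⌋) _ new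
  ...   | inj₁ xy = inj₂ (inj₁ (⌊⌋-sound (a ≟ x) (∧-conicalˡ _ _ xy) , ⌊⌋-sound (b ≟ y) (∧-conicalʳ _ _ xy)))
  ...   | inj₂ yx = inj₂ (inj₂ (⌊⌋-sound (a ≟ y) (∧-conicalˡ _ _ yx) , ⌊⌋-sound (b ≟ x) (∧-conicalʳ _ _ yx)))

  old-edge-avoiding-x : ∀ {a b} → a ≢ x → b ≢ x → Adj G+xy a b → Adj G a b
  old-edge-avoiding-x a≢x b≢x e with addEdge-adj e
  ... | inj₁ old              = old
  ... | inj₂ (inj₁ (a≡x , _)) = ⊥-elim (a≢x a≡x)
  ... | inj₂ (inj₂ (_ , b≡x)) = ⊥-elim (b≢x b≡x)

  old-edge-avoiding-y : ∀ {a b} → a ≢ y → b ≢ y → Adj G+xy a b → Adj G a b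
  old-edge-avoiding-y a≢y b≢y e with addEdge-adj e
  ... | inj₁ old              = old
  ... | inj₂ (inj₁ (_ , b≡y)) = ⊥-elim (b≢y b≡y)
  ... | inj₂ (inj₂ (a≡y , _)) = ⊥-elim (a≢y a≡y)

  addEdge-sym : (∀ a b → adj G a b ≡ adj G b a) → ∀ a b → adj G+xy a b ≡ adj G+xy b a
  addEdge-sym symmetric a b rewrite symmetric a b =
    cong (adj G b a ∨_) (trans (∨-comm (⌊ a ≟ x ⌋ ∧ ⌊ b ≟ y ⌋) (⌊ a ≟ y ⌋ ∧ ⌊ b ≟ x ⌋))
                               (cong₂ _∨_ (∧-comm ⌊ a ≟ y ⌋ ⌊ b ≟ x ⌋) (∧-comm ⌊ a ≟ x ⌋ ⌊ b ≟ y ⌋)))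

  deg-addEdge-other : ∀ w → w ≢ x → w ≢ y → deg G+xy w ≡ deg G w
  deg-addEdge-other w w≢x w≢y = count-cong (adj G+xy w) (adj G w) row
    where
    row : ∀ b → adj G+xy w b ≡ adj G w b
    row b rewrite ⌊⌋-false (w ≟ x) w≢x | ⌊⌋-false (w ≟ y) w≢y = ∨-identityʳ (adj G w b)

  deg-addEdge-x : x ≢ y → ¬ Adj G x y → deg G+xy x ≡ suc (deg G x)
  deg-addEdge-x x≢y x≁y = trans (count-cong (adj G+xy x) _ row) (count-insert (adj G x) y (¬-not x≁y))
    where
    row : ∀ b → adj G+xy x b ≡ adj G x b ∨ ⌊ b ≟ y ⌋
    row b rewrite ⌊⌋-true (x ≟ x) refl | ⌊⌋-false (x ≟ y) x≢y = cong (adj G x b ∨_) (∨-identityʳ ⌊ b ≟ y ⌋)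

  deg-addEdge-y : x ≢ y → ¬ Adj G y x → deg G+xy y ≡ suc (deg G y)
  deg-addEdge-y x≢y y≁x = trans (count-cong (adj G+xy y) _ row) (count-insert (adj G y) x (¬-not y≁x))
    where
    row : ∀ b → adj G+xy y b ≡ adj G y b ∨ ⌊ b ≟ x ⌋
    row b rewrite ⌊⌋-false (y ≟ x) (≢-sym x≢y) | ⌊⌋-true (y ≟ y) refl = refl

module Domination (G : Graph) (symmetric : ∀ a b → adj G a b ≡ adj G b a) (loopless : ∀ a → adj G a a ≡ false)
  (connected : Connected G) (u v : Fin (n G)) (deg-u : deg G u ≡ 1)
  (v-max : ∀ w → deg G w ≤ deg G v) (deg-v : deg G v ≥ 2) (u≁v : ¬ Adj G u v) where

  open SymmetricGraph G symmetric
  open PendantSegment G symmetric connected u deg-u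

  private
    V  = Fin (n G)
    G′ = addEdge G u v

    Nondecreasing′ : List V → Set
    Nondecreasing′ = Linked (λ a b → deg G′ a ≤ deg G′ b)

  u≢v : u ≢ v
  u≢v refl = 1+n≰n (subst (2 ≤_) deg-u deg-v)

  Adj-irreflexive : ∀ {a b} → Adj G a b → a ≢ b
  Adj-irreflexive {a} e refl with trans (sym e) (loopless a)
  ... | ()

  deg′-u : deg G′ u ≡ 2
  deg′-u = trans (deg-addEdge-x G u v u≢v u≁v) (cong suc deg-u)

  deg′-v : deg G′ v ≡ suc (deg G v)
  deg′-v = deg-addEdge-y G u v u≢v (u≁v ∘ Adj-sym)

  v-strict-max : ∀ {c} → c ≢ u → c ≢ v → deg G′ v ≤ deg G′ c → ⊥
  v-strict-max {c} c≢u c≢v v≤c = 1+n≰n (begin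
    suc (deg G v) ≡⟨ sym deg′-v ⟩
    deg G′ v      ≤⟨ v≤c ⟩
    deg G′ c      ≡⟨ deg-addEdge-other G u v c c≢u c≢v ⟩
    deg G c       ≤⟨ v-max c ⟩
    deg G v       ∎)
    where open ≤-Reasoning

  -- a vertex of G′-degree at most 2 is not v, as v has G′-degree at least 3
  small-≢v : ∀ {a} → deg G′ a ≤ 2 → a ≢ v
  small-≢v a≤2 refl = 1+n≰n (≤-trans (s≤s deg-v) (subst (_≤ 2) deg′-v a≤2))

  order-avoiding-u : ∀ {a b} → u ≢ a → u ≢ b → deg G′ a ≤ deg G′ b → deg G a ≤ deg G b
  order-avoiding-u {a} {b} u≢a u≢b a≤b = by-cases (b ≟ v) (a ≟ v)
    where
    by-cases : Dec (b ≡ v) → Dec (a ≡ v) → deg G a ≤ deg G b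
    by-cases (yes refl) _          = v-max a
    by-cases (no b≢v)   (yes refl) = ⊥-elim (v-strict-max (≢-sym u≢b) b≢v a≤b)
    by-cases (no b≢v)   (no a≢v)   =
      subst₂ _≤_ (deg-addEdge-other G u v a (≢-sym u≢a) a≢v) (deg-addEdge-other G u v b (≢-sym u≢b) b≢v) a≤b

  avoiding-u : ∀ {p} → All (u ≢_) p → Linked (Adj G′) p → Nondecreasing′ p →
    Linked (Adj G) p × Linked (λ a b → deg G a ≤ deg G b) p
  avoiding-u avoid L M =
    linked-map-on (λ u≢a u≢b → old-edge-avoiding-x G u v (≢-sym u≢a) (≢-sym u≢b)) avoid L ,
    linked-map-on order-avoiding-u avoid M

  Dominated : List V → Set
  Dominated p = Σ (List V) λ q → IsDegMonotonePath G q × length p ≤ length q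

  data AfterU : List V → Set where
    nothing-after : AfterU []
    only-v        : AfterU [ v ]
    old-edge      : ∀ {y B} → Adj G u y → AfterU (y ∷ B)

  after-u : ∀ B → IsPath G′ (u ∷ B) → Nondecreasing′ (u ∷ B) → AfterU B
  after-u []      _             _       = nothing-after
  after-u (y ∷ B) (U , u~y ∷ _) (_ ∷ M) with addEdge-adj G u v u~y
  ... | inj₁ old               = old-edge old
  ... | inj₂ (inj₂ (u≡v , _))  = ⊥-elim (u≢v u≡v)
  ... | inj₂ (inj₁ (_ , refl)) = nothing-after-v B U M
    where
    nothing-after-v : ∀ B → Unique (u ∷ v ∷ B) → Nondecreasing′ (v ∷ B) → AfterU (v ∷ B)
    nothing-after-v []      _                                _         = only-v
    nothing-after-v (c ∷ _) ((_ ∷ u≢c ∷ _) ∷ (v≢c ∷ _) ∷ _) (v≤c ∷ _) =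
      ⊥-elim (v-strict-max (≢-sym u≢c) (≢-sym v≢c) v≤c)

  at-most-one-after-u : ∀ {z} B → Adj G z u → z ∉ B → IsPath G′ (u ∷ B) → Nondecreasing′ (u ∷ B) → length B ≤ 1
  at-most-one-after-u B z~u z∉ path M with after-u B path M
  ... | nothing-after = z≤n
  ... | only-v        = s≤s z≤n
  ... | old-edge u~y  = ⊥-elim (z∉ (here (leaf-neighbour-unique (Adj-sym z~u) u~y)))

  via-old-edge : ∀ {y B} → Adj G u y → IsPath G′ (u ∷ y ∷ B) → Nondecreasing′ (u ∷ y ∷ B) →
    IsDegMonotonePath G (u ∷ y ∷ B)
  via-old-edge u~y (U@(u∉ ∷ _) , _ ∷ L) (_ ∷ M) with avoiding-u u∉ L M
  ... | L′ , M′ = (U , u~y ∷ L′) , inj₁ (leaf-below u~y ∷ M′)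

  from-u : ∀ B → IsPath G′ (u ∷ B) → Nondecreasing′ (u ∷ B) → Dominated (u ∷ B)
  from-u B path M with after-u B path M
  ... | nothing-after = [ u ] , (([] ∷ [] , [-]) , inj₁ [-]) , ≤-refl
  ... | old-edge u~y  = u ∷ B , via-old-edge u~y path M , ≤-refl
  ... | only-v with neighbour G (≤-reflexive (sym deg-u))
  ...   | w , u~w = u ∷ w ∷ [] , ((((Adj-irreflexive u~w ∷ []) ∷ [] ∷ []) , u~w ∷ [-]) , inj₁ (leaf-below u~w ∷ [-])) , ≤-refl

  -- nondecreasing G′-paths w ∷ A′ ++ u ∷ B passing through u after a nonempty part A:
  -- A ++ [u] is a pendant segment of G missing v, and B has at most one vertex
  through-u : ∀ w A′ B → IsPath G′ (w ∷ A′ ++ u ∷ B) → Nondecreasing′ (w ∷ A′ ++ u ∷ B) → Dominated (w ∷ A′ ++ u ∷ B)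
  through-u w A′ B (U , L) M = extended (pendant-extension w A′ segment small v∉segment deg-v)
    where
    A = w ∷ A′
    below-u : All (λ a → deg G′ a ≤ 2) A
    below-u = All.map (λ a≤u → ≤-trans a≤u (≤-reflexive deg′-u)) (linked-before ≤-trans A u B M)
    segment-≢v : All (_≢ v) (A ++ [ u ])
    segment-≢v = ∷ʳ⁺ (All.map small-≢v below-u) u≢v
    A-≢u : All (_≢ u) A
    A-≢u = All.tabulate (λ a∈ → unique-disjoint A U a∈ (here refl))
    small : All (λ a → deg G a ≤ 2) A
    small = All.zipWith (λ { (a≤2 , a≢u , a≢v) → subst (_≤ 2) (deg-addEdge-other G u v _ a≢u a≢v) a≤2 })
                        (below-u , All.zip (A-≢u , ++⁻ˡ A segment-≢v))
    segment : IsPath G (A ++ [ u ])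
    segment = unique-prefix A u B U , linked-map-on (old-edge-avoiding-y G u v) segment-≢v (linked-prefix A u B L)
    v∉segment : v ∉ A ++ [ u ]
    v∉segment v∈ = All.lookup segment-≢v v∈ refl
    B-short : length B ≤ 1
    B-short with last-edge w A′ u (proj₂ segment)
    ... | z , z∈ , z~u = at-most-one-after-u B z~u (λ z∈B → unique-disjoint A U z∈ (there z∈B) refl)
                           (unique-suffix A U , linked-suffix A (u ∷ B) L) (linked-suffix A (u ∷ B) M)
    extended : Σ V (λ x → IsDegMonotonePath G (x ∷ A ++ [ u ])) → Dominated (A ++ u ∷ B)
    extended (x , dmp) = x ∷ A ++ [ u ] , dmp , (begin
      length (A ++ u ∷ B)       ≡⟨ length-++ A ⟩
      length A + suc (length B) ≤⟨ +-monoʳ-≤ (length A) (s≤s B-short) ⟩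
      length A + 2              ≡⟨ +-suc (length A) 1 ⟩
      suc (length A + 1)        ≡⟨ cong suc (sym (length-++ A)) ⟩
      length (x ∷ A ++ [ u ])   ∎)
      where open ≤-Reasoning

  dominated-nondecreasing : ∀ p → IsNondecreasingPath G′ p → Dominated p
  dominated-nondecreasing p ((U , L) , M) with Any.any? (u ≟_) p
  ... | no u∉ with avoiding-u (¬Any⇒All¬ p u∉) L M
  ...   | L′ , M′ = p , ((U , L′) , inj₁ M′) , ≤-refl
  dominated-nondecreasing p ((U , L) , M) | yes u∈ with ∈-∃++ u∈
  ... | []     , B , refl = from-u B (U , L) M
  ... | w ∷ A′ , B , refl = through-u w A′ B (U , L) M

  dominated : ∀ p → IsDegMonotonePath G′ p → Dominated p
  dominated p dmp with nondecreasing-form G′ (addEdge-sym G u v symmetric) p dmp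
  ... | q , nondecreasing , |q|≡|p| with dominated-nondecreasing q nondecreasing
  ...   | r , dmr , |q|≤|r| = r , dmr , subst (_≤ length r) |q|≡|p| |q|≤|r|

-- mp(H) exists: degree monotone paths are decidable, have at most n H vertices,
-- and there are finitely many vertex lists of each length.

list-of-length? : ∀ {m} (D : List (Fin m) → Set) → (∀ p → Dec (D p)) → ∀ k →
  Dec (Σ (List (Fin m)) λ p → length p ≡ k × D p)
list-of-length? D D? zero with D? []
... | yes d  = yes ([] , refl , d)
... | no ¬d = no λ { ([] , _ , d) → ¬d d ; (_ ∷ _ , () , _) }
list-of-length? D D? (suc k) with any? (λ x → list-of-length? (D ∘ (x ∷_)) (D? ∘ (x ∷_)) k)
... | yes (x , p , |p|≡k , d) = yes (x ∷ p , cong suc |p|≡k , d)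
... | no none = no λ { ([] , () , _) ; (x ∷ p , |p|≡k , d) → none (x , p , suc-injective |p|≡k , d) }

largest-witness : (Q : ℕ → Set) → (∀ k → Dec (Q k)) → Q 0 → ∀ N → (∀ k → Q k → k ≤ N) →
  Σ ℕ λ m → Q m × (∀ k → Q k → k ≤ m)
largest-witness Q Q? q0 N bound with Q? N
... | yes qN = N , qN , bound
largest-witness Q Q? q0 zero    bound | no ¬qN = ⊥-elim (¬qN q0)
largest-witness Q Q? q0 (suc N) bound | no ¬qN =
  largest-witness Q Q? q0 N (λ k qk → ≤-pred (≤∧≢⇒< (bound k qk) (λ k≡N → ¬qN (subst Q k≡N qk))))

degMonotonePath? : ∀ H p → Dec (IsDegMonotonePath H p)
degMonotonePath? H p =
  (UniqueDec.unique? _≟_ p ×-dec linked? (λ a b → adj H a b ≟ᵇ true) p) ×-dec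
  (linked? (λ a b → deg H a ≤? deg H b) p ⊎-dec linked? (λ a b → deg H b ≤? deg H a) p)

mp-exists : ∀ H → Σ ℕ (IsMP H)
mp-exists H with largest-witness PathOfLength (list-of-length? (IsDegMonotonePath H) (degMonotonePath? H))
                   ([] , refl , (([] , []) , inj₁ [])) (n H) (λ { k (p , refl , ((U , _) , _)) → distinct-length-≤ U })
  where
  PathOfLength : ℕ → Set
  PathOfLength k = Σ (List (Fin (n H))) λ p → length p ≡ k × IsDegMonotonePath H p
... | m , (p , |p|≡m , dmp) , largest = m , (p , dmp , |p|≡m) , λ q dmq → largest (length q) (q , refl , dmq)

lemma2p2 : (G : Graph) → IsSimple G → Connected G →
    (u v : Fin (n G)) → deg G u ≡ 1 →
    (∀ w → deg G w ≤ deg G v) → deg G v ≥ 2 → ¬ Adj G u v →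
    (∀ a b → IsMP G a → IsMP (addEdge G u v) b → b ≤ a) × ¬ Saturated G
lemma2p2 G (symmetric , loopless) connected u v deg-u v-max deg-v u≁v = mp-not-larger , not-saturated
  where
  open Domination G symmetric loopless connected u v deg-u v-max deg-v u≁v

  mp-not-larger : ∀ a b → IsMP G a → IsMP (addEdge G u v) b → b ≤ a
  mp-not-larger a b (_ , longest) ((p , dmp , refl) , _) with dominated p dmp
  ... | q , dmq , |p|≤|q| = ≤-trans |p|≤|q| (longest q dmq)

  not-saturated : ¬ Saturated G
  not-saturated saturated with mp-exists G | mp-exists (addEdge G u v)
  ... | a , mp-a | b , mp-b = <⇒≱ (saturated u v u≢v u≁v a b mp-a mp-b) (mp-not-larger a b mp-a mp-b)
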